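{- Let $n,d\ge1$ and let $n\Delta_{d-1}'\subset\mathbb{R}^{d-1}$ be the image of $n\Delta_{d-1}$ under the projection $(x_1,\dots,x_d)\mapsto(x_1,\dots,x_{d-1})$, carrying the image of a fine mixed subdivision of $n\Delta_{d-1}$. Let $T=(I_1,\dots,I_n)$ be a cell of it, viewed as a spanning tree of $K_{n,d}$. Let $e=(i,j)$ be an edge of $T$ whose left endpoint $i$ is not a leaf of $T$, and let $F_e$ be the facet of $T$ whose type is $T\setminus e$ (i.e. $I_i$ replaced by $I_i\setminus\{j\}$). Let $I_e\subseteq[d]$ be the set of right vertices which are not in the same connected component as the right vertex $d$ in $T\setminus e$. Then the affine hull of $F_e$ is given by an equation $\sum_{j\in I_e}x_j=c$ for some $c\in\mathbb{Z}$.
   Context: $\Delta_{d-1}=\mathrm{conv}(e_1,\dots,e_d)\subset\mathbb{R}^d$, $\Delta_I=\mathrm{conv}(e_j:j\in I)$, and $n\Delta_{d-1}$ is the Minkowski sum of $n$ copies of $\Delta_{d-1}$; it lies in the hyperplane $x_1+\dots+x_d=n$, so the projection forgetting $x_d$ is injective on it. In a fine mixed subdivision of $n\Delta_{d-1}$ each cell is $\Delta_{I_1}+\dots+\Delta_{I_n}$ with $\sum(|I_i|-1)=d-1$, and $(I_1,\dots,I_n)$ is identified with the spanning tree of the complete bipartite graph $K_{n,d}$ (left vertices $[n]$, right vertices $[d]$) with edges $(i,j)$ for $j\in I_i$; a type $(J_1,\dots,J_n)$ with $\emptyset\neq J_i\subseteq I_i$ denotes the face $\Delta_{J_1}+\dots+\Delta_{J_n}$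 of the cell (here taken after projection).
   Formalization: Points have rational coordinates, lying in ℚ^(d-1) instead of ℝ^(d-1), and the affine hull of $F_e$ is taken over ℚ as the set of rational affine combinations of its points. -}

module Defs where

open import Data.Nat using (ℕ; zero; suc; _+_; _∸_)
open import Data.Fin using (Fin; zero; suc; inject₁; fromℕ; _≟_)
open import Data.Fin.Subset using (Subset; _∈_; _∉_; ∣_∣; outside)
open import Data.Vec using (lookup; _[_]≔_)
open import Data.Bool using (if_then_else_)
open import Data.Sum using (_⊎_; inj₁; inj₂)
open import Data.Product using (Σ; _×_; ∃)
open import Data.Integer using (ℤ)
open import Data.Rational using (ℚ; 0ℚ; 1ℚ; _≤_) renaming (_+_ to _+ℚ_; _*_ to _*ℚ_)
open import Relation.Nullary using (¬_)
open import Relation.Nullary.Decidable using (⌊_⌋)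
open import Relation.Binary.PropositionalEquality using (_≡_)

-- Subgraphs of the complete bipartite graph K_{n,d}.
-- A subgraph is given by T : Fin n → Subset d, where left vertex i is
-- adjacent to right vertex j iff j ∈ T i  (so T = (I_1,…,I_n)).

BipGraph : ℕ → ℕ → Set
BipGraph n d = Fin n → Subset d

Vertex : ℕ → ℕ → Set
Vertex n d = Fin n ⊎ Fin d

data Adj {n d : ℕ} (T : BipGraph n d) : Vertex n d → Vertex n d → Set where
  lr : ∀ i j → j ∈ T i → Adj T (inj₁ i) (inj₂ j)
  rl : ∀ i j → j ∈ T i → Adj T (inj₂ j) (inj₁ i)

data Reach {n d : ℕ} (T : BipGraph n d) : Vertex n d → Vertex n d → Set where
  here : ∀ {u} → Reach T u u
  step : ∀ {u v w} → Adj T u v → Reach T v w → Reach T u w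

Connected : {n d : ℕ} → BipGraph n d → Set
Connected T = ∀ u v → Reach T u v

numEdges : {n d : ℕ} → BipGraph n d → ℕ
numEdges {zero}  T = 0
numEdges {suc n} T = ∣ T zero ∣ + numEdges (λ i → T (suc i))

-- spanning tree of K_{n,d}: connected with (n + d) - 1 edges,
-- i.e. Σ (|I_i| - 1) = d - 1 as in the description of fine mixed cells.
SpanningTree : {n d : ℕ} → BipGraph n d → Set
SpanningTree {n} {d} T = Connected T × numEdges T ≡ (n + d) ∸ 1

delEdge : {n d : ℕ} → BipGraph n d → Fin n → Fin d → BipGraph n d
delEdge T i j k = if ⌊ k ≟ i ⌋ then (T k [ j ]≔ outside) else T k

sumℚ : {k : ℕ} → (Fin k → ℚ) → ℚ
sumℚ {zero}  f = 0ℚ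
sumℚ {suc k} f = f zero +ℚ sumℚ (λ t → f (suc t))

Point : ℕ → Set
Point d = Fin d → ℚ

InSimplex : {d : ℕ} → Subset d → Point d → Set
InSimplex {d} J x =
  (∀ j → 0ℚ ≤ x j) × (∀ j → j ∉ J → x j ≡ 0ℚ) × (sumℚ x ≡ 1ℚ)

InMinkowski : {n d : ℕ} → BipGraph n d → Point d → Set
InMinkowski {n} {d} J y =
  Σ (Fin n → Point d) λ p → (∀ k → InSimplex (J k) (p k)) ×
                            (∀ j → y j ≡ sumℚ (λ k → p k j))

InProjMinkowski : {n m : ℕ} → BipGraph n (suc m) → Point m → Set
InProjMinkowski {n} {m} J x =
  Σ (Point (suc m)) λ y → InMinkowski J y × (∀ j → x j ≡ y (inject₁ j))

InAffineHull : {m : ℕ} → (Point m → Set) → Point m → Set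
InAffineHull {m} S x =
  Σ ℕ λ r → Σ (Fin r → ℚ) λ c → Σ (Fin r → Point m) λ q →
    (∀ t → S (q t)) × (sumℚ c ≡ 1ℚ) ×
    (∀ j → x j ≡ sumℚ (λ t → c t *ℚ q t j))

-- Σ_{j ∈ I} x_j for a point of ℚ^{d-1}, I ⊆ [d]  (coordinate d is absent;
-- it is never in I_e)
partialSum : {m : ℕ} → Subset (suc m) → Point m → ℚ
partialSum {m} I x = sumℚ (λ j → if lookup I (inject₁ j) then x j else 0ℚ)

module Submission where

-- Since T has exactly
-- n + d - 1 edges, the endpoints i, j of e are disconnected in T', while every
-- vertex still reaches i or j.  So T' has two components, I_e being the right
-- vertices of the one avoiding d; every left vertex k keeps a neighbour in T'
-- and all neighbours of k lie on the same side of I_e.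
-- Geometry part.  (⇒) A point of Δ_{T' k} has mass 0 or 1 on I_e, so
-- Σ_{a ∈ I_e} x_a = c (the number of left vertices on the I_e side) on F_e,
-- and this linear level passes to the affine hull.  (⇐) The hull contains a
-- base point and is closed under translation by e_a - e_b for a, b joined in
-- T'; with a root ρ a in each component (e_d projects to 0), every x on the
-- hyperplane is the base point plus a combination of the e_a - e_{ρ a}.

open import Defs
open import Algebra.Bundles using (CommutativeRing)
open import Data.Bool using (Bool; true; false; if_then_else_)
open import Data.Empty using (⊥-elim)
open import Data.Fin as F using (Fin; zero; suc; fromℕ; inject₁; join; splitAt)
import Data.Fin.Properties as FP
open import Data.Fin.Subset using (Subset; _∈_; _∉_; ∣_∣; inside; outside)
open import Data.Fin.Subset.Properties using (_∈?_)
open import Data.Integer as ℤ using (ℤ)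
import Data.Integer.Properties as ℤP
open import Data.List using (List; []; _∷_; map; _++_; length)
import Data.List.Properties as LP
open import Data.List.Relation.Unary.Any using (here; there)
import Data.List.Membership.Propositional as List
import Data.List.Membership.Propositional.Properties as ListP
open import Data.Nat as ℕ using (ℕ; zero; suc; _≤_; z≤n; s≤s)
import Data.Nat.Properties as ℕP
open import Data.Product using (Σ; _×_; _,_; proj₁; proj₂)
open import Data.Rational using (ℚ; 0ℚ; 1ℚ; _+_; _*_; -_; _-_; _/_)
import Data.Rational as ℚ
open import Data.Rational.Properties as ℚP
  using (+-*-commutativeRing; +-identityʳ; +-identityˡ; *-zeroʳ; *-zeroˡ;
         *-identityˡ; *-identityʳ; *-comm; +-inverseʳ)
open import Data.Rational.Solver using (module +-*-Solver)
open +-*-Solver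
import Data.Rational.Unnormalised as ℚᵘ
import Data.Rational.Unnormalised.Properties as ℚᵘP
open import Data.Sum using (_⊎_; inj₁; inj₂)
open import Data.Vec using ([]; _∷_; lookup; _[_]≔_; here; there)
open import Data.Vec.Properties using ([]=⇒lookup; lookup⇒[]=)
open import Function.Bundles using (_⇔_; mk⇔; Equivalence)
open import Relation.Nullary using (¬_; yes; no)
open import Relation.Nullary.Decidable using (⌊_⌋)
open import Relation.Binary.PropositionalEquality

import Algebra.Properties.Semiring.Sum (CommutativeRing.semiring +-*-commutativeRing) as Σℚ

-- Finite sums over ℚ.  'sumℚ' is the library's semiring sum 'Σℚ.sum' by a
-- different recursion, so its laws are transported from the library.

sumℚ≡sum : ∀ {k} (f : Fin k → ℚ) → sumℚ f ≡ Σℚ.sum f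
sumℚ≡sum {zero}  f = refl
sumℚ≡sum {suc k} f = cong (f zero +_) (sumℚ≡sum (λ t → f (suc t)))

sumℚ-cong : ∀ {k} {f g : Fin k → ℚ} → (∀ t → f t ≡ g t) → sumℚ f ≡ sumℚ g
sumℚ-cong {f = f} {g} f≗g =
  trans (sumℚ≡sum f) (trans (Σℚ.sum-cong-≗ f≗g) (sym (sumℚ≡sum g)))

sumℚ-zero : ∀ k → sumℚ {k} (λ _ → 0ℚ) ≡ 0ℚ
sumℚ-zero k = trans (sumℚ≡sum {k} (λ _ → 0ℚ)) (Σℚ.sum-replicate-zero k)

sumℚ-scale : ∀ {k} (a : ℚ) (f : Fin k → ℚ) → sumℚ (λ t → a * f t) ≡ a * sumℚ f
sumℚ-scale a f = trans (sumℚ≡sum (λ t → a * f t))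
  (sym (trans (cong (a *_) (sumℚ≡sum f)) (Σℚ.*-distribˡ-sum a f)))

sumℚ-comm : ∀ {k l} (f : Fin k → Fin l → ℚ) →
            sumℚ (λ s → sumℚ (f s)) ≡ sumℚ (λ t → sumℚ (λ s → f s t))
sumℚ-comm f = begin
  sumℚ (λ s → sumℚ (f s))                   ≡⟨ sumℚ-cong (λ s → sumℚ≡sum (f s)) ⟩
  sumℚ (λ s → Σℚ.sum (f s))                 ≡⟨ sumℚ≡sum (λ s → Σℚ.sum (f s)) ⟩
  Σℚ.sum (λ s → Σℚ.sum (f s))               ≡⟨ Σℚ.∑-comm f ⟩
  Σℚ.sum (λ t → Σℚ.sum (λ s → f s t))       ≡⟨ sumℚ≡sum (λ t → Σℚ.sum (λ s → f s t)) ⟨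
  sumℚ (λ t → Σℚ.sum (λ s → f s t))         ≡⟨ sumℚ-cong (λ t → sumℚ≡sum (λ s → f s t)) ⟨
  sumℚ (λ t → sumℚ (λ s → f s t))           ∎
  where open ≡-Reasoning

sumℚ-init-last : ∀ {m} (f : Fin (suc m) → ℚ) →
                 sumℚ f ≡ sumℚ (λ t → f (inject₁ t)) + f (fromℕ m)
sumℚ-init-last f = trans (sumℚ≡sum f)
  (trans (Σℚ.sum-init-last f) (cong (_+ f (fromℕ _)) (sym (sumℚ≡sum (λ t → f (inject₁ t))))))

-- Subtraction is not a semiring operation, so this one is proved directly.
sumℚ-− : ∀ {k} (f g : Fin k → ℚ) → sumℚ (λ t → f t - g t) ≡ sumℚ f - sumℚ g
sumℚ-− {zero}  f g = refl
sumℚ-− {suc k} f g =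
  trans (cong ((f zero - g zero) +_) (sumℚ-− (λ t → f (suc t)) (λ t → g (suc t))))
    (solve 4 (λ a b c e → (a :- b) :+ (c :- e) := (a :+ c) :- (b :+ e)) refl
       (f zero) (g zero) (sumℚ (λ t → f (suc t))) (sumℚ (λ t → g (suc t))))

bit : Bool → ℕ
bit true  = 1
bit false = 0

count : ∀ {K} → (Fin K → Bool) → ℕ
count {zero}  p = 0
count {suc K} p = bit (p zero) ℕ.+ count (λ w → p (suc w))

bit-mono : ∀ {a b} → (a ≡ true → b ≡ true) → bit a ≤ bit b
bit-mono {false}        _   = z≤n
bit-mono {true} {true}  _   = ℕP.≤-refl
bit-mono {true} {false} a⇒b with a⇒b refl
... | ()

count-mono : ∀ {K} (p q : Fin K → Bool) → (∀ w → p w ≡ true → q w ≡ true) →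
             count p ≤ count q
count-mono {zero}  p q p⇒q = z≤n
count-mono {suc K} p q p⇒q =
  ℕP.+-mono-≤ (bit-mono (p⇒q zero))
              (count-mono (λ w → p (suc w)) (λ w → q (suc w)) (λ w → p⇒q (suc w)))

count-drop : ∀ {K} (p q : Fin K → Bool) (w₀ : Fin K) →
             (∀ w → w ≢ w₀ → p w ≡ true → q w ≡ true) → count p ≤ suc (count q)
count-drop {suc K} p q zero p⇒q =
  ℕP.+-mono-≤ (bit≤1 (p zero))
    (ℕP.≤-trans (count-mono (λ w → p (suc w)) (λ w → q (suc w)) (λ w → p⇒q (suc w) (λ ())))
                (ℕP.m≤n+m _ (bit (q zero))))
  where
  bit≤1 : ∀ a → bit a ≤ 1
  bit≤1 true  = ℕP.≤-refl
  bit≤1 false = z≤n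
count-drop {suc K} p q (suc w₀) p⇒q =
  ℕP.≤-trans
    (ℕP.+-mono-≤ (bit-mono (p⇒q zero (λ ())))
                 (count-drop (λ w → p (suc w)) (λ w → q (suc w)) w₀
                             (λ w w≢w₀ → p⇒q (suc w) (λ e → w≢w₀ (FP.suc-injective e)))))
    (ℕP.≤-reflexive (ℕP.+-suc (bit (q zero)) _))

count-none : ∀ {K} (p : Fin K → Bool) → (∀ w → p w ≢ true) → count p ≡ 0
count-none {zero}  p none = refl
count-none {suc K} p none with p zero in e
... | true  = ⊥-elim (none zero e)
... | false = count-none (λ w → p (suc w)) (λ w → none (suc w))

count-atMostOne : ∀ {K} (p : Fin K → Bool) →
                  (∀ w w' → p w ≡ true → p w' ≡ true → w ≡ w') → count p ≤ 1
count-atMostOne {zero}  p unique = z≤n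
count-atMostOne {suc K} p unique with p zero in e
... | true  = ℕP.≤-reflexive (cong suc (count-none (λ w → p (suc w))
                (λ w e' → FP.0≢1+n (unique zero (suc w) e e'))))
... | false = count-atMostOne (λ w → p (suc w))
                (λ w w' e₁ e₂ → FP.suc-injective (unique (suc w) (suc w') e₁ e₂))

count-all : ∀ {K} (p : Fin K → Bool) → (∀ w → p w ≡ true) → count p ≡ K
count-all {zero}  p all = refl
count-all {suc K} p all rewrite all zero = cong suc (count-all (λ w → p (suc w)) (λ w → all (suc w)))

-- A labelling of Fin N
-- assigns to each vertex the representative of its class; merging two classes
-- along an edge destroys at most one representative.  Running this along all
-- edges of a graph yields an edge-invariant labelling with at least
-- N - (number of edges) representatives.

module UnionFind {N : ℕ} where

  Labelling : Set
  Labelling = Fin N → Fin N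

  isRep : Labelling → Fin N → Bool
  isRep f w = ⌊ f w F.≟ w ⌋

  merge : Labelling → Fin N → Fin N → Labelling
  merge f u v w = if ⌊ f w F.≟ f u ⌋ then f v else f w

  mergeAll : List (Fin N × Fin N) → Labelling → Labelling
  mergeAll []             f = f
  mergeAll ((u , v) ∷ es) f = mergeAll es (merge f u v)

  merge-reps : ∀ f u v → count (isRep f) ≤ suc (count (isRep (merge f u v)))
  merge-reps f u v = count-drop (isRep f) (isRep (merge f u v)) (f u) keeps
    where
    keeps : ∀ w → w ≢ f u → isRep f w ≡ true → isRep (merge f u v) w ≡ true
    keeps w w≢fu rep with f w F.≟ w
    keeps w w≢fu ()  | no _
    keeps w w≢fu rep | yes fw≡w with f w F.≟ f u
    ... | yes fw≡fu = ⊥-elim (w≢fu (trans (sym fw≡w) fw≡fu))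
    ... | no _ with f w F.≟ w
    ...   | yes _    = refl
    ...   | no fw≢w = ⊥-elim (fw≢w fw≡w)

  mergeAll-reps : ∀ es f → count (isRep f) ≤ length es ℕ.+ count (isRep (mergeAll es f))
  mergeAll-reps []             f = ℕP.≤-refl
  mergeAll-reps ((u , v) ∷ es) f =
    ℕP.≤-trans (merge-reps f u v) (s≤s (mergeAll-reps es (merge f u v)))

  mergeAll-keeps : ∀ es f a b → f a ≡ f b → mergeAll es f a ≡ mergeAll es f b
  mergeAll-keeps []             f a b fa≡fb = fa≡fb
  mergeAll-keeps ((u , v) ∷ es) f a b fa≡fb = mergeAll-keeps es (merge f u v) a b merge-keeps
    where
    merge-keeps : merge f u v a ≡ merge f u v b
    merge-keeps with f a F.≟ f u | f b F.≟ f u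
    ... | yes _   | yes _   = refl
    ... | no _    | no _    = fa≡fb
    ... | yes a~u | no b≁u  = ⊥-elim (b≁u (trans (sym fa≡fb) a~u))
    ... | no a≁u  | yes b~u = ⊥-elim (a≁u (trans fa≡fb b~u))

  mergeAll-edge : ∀ es f {u v} → (u , v) List.∈ es → mergeAll es f u ≡ mergeAll es f v
  mergeAll-edge ((u , v) ∷ es) f (here refl) = mergeAll-keeps es (merge f u v) u v merge-joins
    where
    merge-joins : merge f u v u ≡ merge f u v v
    merge-joins with f u F.≟ f u | f v F.≟ f u
    ... | no fu≢fu | _     = ⊥-elim (fu≢fu refl)
    ... | yes _    | yes _ = refl
    ... | yes _    | no _  = refl
  mergeAll-edge ((u' , v') ∷ es) f (there uv∈es) = mergeAll-edge es (merge f u' v') uv∈es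

EdgeInvariant : ∀ {N} {A : Set} → List (Fin N × Fin N) → (Fin N → A) → Set
EdgeInvariant es f = ∀ {u v} → (u , v) List.∈ es → f u ≡ f v

connected⇒edges : ∀ {N} (es : List (Fin N × Fin N)) →
                  (∀ (f : Fin N → Fin N) → EdgeInvariant es f → ∀ w w' → f w ≡ f w') →
                  N ≤ suc (length es)
connected⇒edges {N} es connected = begin
  N                                       ≡⟨ count-all (isRep (λ w → w)) idRep ⟨
  count (isRep (λ w → w))                 ≤⟨ mergeAll-reps es (λ w → w) ⟩
  length es ℕ.+ count (isRep components)  ≤⟨ ℕP.+-monoʳ-≤ (length es) oneRep ⟩
  length es ℕ.+ 1                         ≡⟨ ℕP.+-comm (length es) 1 ⟩
  suc (length es)                         ∎
  where
  open UnionFind {N}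
  open ℕP.≤-Reasoning
  components : Labelling
  components = mergeAll es (λ w → w)
  idRep : ∀ w → isRep (λ w → w) w ≡ true
  idRep w with w F.≟ w
  ... | yes _   = refl
  ... | no w≢w = ⊥-elim (w≢w refl)
  oneRep : count (isRep components) ≤ 1
  oneRep = count-atMostOne (isRep components) unique
    where
    rep⇒fixed : ∀ w → isRep components w ≡ true → components w ≡ w
    rep⇒fixed w rep with components w F.≟ w
    ... | yes fixed = fixed
    rep⇒fixed w () | no _
    unique : ∀ w w' → isRep components w ≡ true → isRep components w' ≡ true → w ≡ w'
    unique w w' rep rep' =
      trans (sym (rep⇒fixed w rep))
            (trans (connected components (mergeAll-edge es (λ w → w)) w w') (rep⇒fixed w' rep'))

∣∣-remove : ∀ {d} (S : Subset d) j → j ∈ S → ∣ S ∣ ≡ suc ∣ S [ j ]≔ outside ∣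
∣∣-remove (inside ∷ S)  zero    here       = refl
∣∣-remove (inside ∷ S)  (suc j) (there j∈) = cong suc (∣∣-remove S j j∈)
∣∣-remove (outside ∷ S) (suc j) (there j∈) = ∣∣-remove S j j∈

nonempty⇒elem : ∀ {d} (S : Subset d) → 1 ≤ ∣ S ∣ → Σ (Fin d) (_∈ S)
nonempty⇒elem (inside ∷ S)  _  = zero , here
nonempty⇒elem (outside ∷ S) ne with nonempty⇒elem S ne
... | a , a∈ = suc a , there a∈

∈-remove : ∀ {d} (S : Subset d) j a → a ∈ S → a ≢ j → a ∈ S [ j ]≔ outside
∈-remove (_ ∷ S) zero    zero    _          a≢j = ⊥-elim (a≢j refl)
∈-remove (_ ∷ S) (suc j) zero    here       _   = here
∈-remove (_ ∷ S) zero    (suc a) (there a∈) _   = there a∈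
∈-remove (_ ∷ S) (suc j) (suc a) (there a∈) a≢j =
  there (∈-remove S j a a∈ (λ a≡j → a≢j (cong suc a≡j)))

Adj-sym : ∀ {n d} {T : BipGraph n d} {u v} → Adj T u v → Adj T v u
Adj-sym (lr i j j∈) = rl i j j∈
Adj-sym (rl i j j∈) = lr i j j∈

Reach-trans : ∀ {n d} {T : BipGraph n d} {u v w} → Reach T u v → Reach T v w → Reach T u w
Reach-trans here           q = q
Reach-trans (step uv p) q = step uv (Reach-trans p q)

Reach-sym : ∀ {n d} {T : BipGraph n d} {u v} → Reach T u v → Reach T v u
Reach-sym here         = here
Reach-sym (step uv p) = Reach-trans (Reach-sym p) (step (Adj-sym uv) here)

elements : ∀ {d} → Subset d → List (Fin d)
elements []          = []
elements (true ∷ S)  = zero ∷ map suc (elements S)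
elements (false ∷ S) = map suc (elements S)

length-elements : ∀ {d} (S : Subset d) → length (elements S) ≡ ∣ S ∣
length-elements []          = refl
length-elements (true ∷ S)  = cong suc (trans (LP.length-map suc (elements S)) (length-elements S))
length-elements (false ∷ S) = trans (LP.length-map suc (elements S)) (length-elements S)

∈-elements : ∀ {d} (S : Subset d) {a} → a ∈ S → a List.∈ elements S
∈-elements (true ∷ S)  here       = here refl
∈-elements (true ∷ S)  (there a∈) = there (ListP.∈-map⁺ suc (∈-elements S a∈))
∈-elements (false ∷ S) (there a∈) = ListP.∈-map⁺ suc (∈-elements S a∈)

edgeList : ∀ {n d} {V : Set} → (Fin n → V) → (Fin d → V) → BipGraph n d → List (V × V)
edgeList {zero}  L R T = []
edgeList {suc n} L R T =
  map (λ a → (L zero , R a)) (elements (T zero)) ++ edgeList (λ k → L (suc k)) R (λ k → T (suc k))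

length-edgeList : ∀ {n d} {V : Set} (L : Fin n → V) (R : Fin d → V) T →
                  length (edgeList L R T) ≡ numEdges T
length-edgeList {zero}  L R T = refl
length-edgeList {suc n} L R T =
  trans (LP.length-++ (map (λ a → (L zero , R a)) (elements (T zero))))
    (cong₂ ℕ._+_ (trans (LP.length-map _ (elements (T zero))) (length-elements (T zero)))
                 (length-edgeList (λ k → L (suc k)) R (λ k → T (suc k))))

∈-edgeList : ∀ {n d} {V : Set} (L : Fin n → V) (R : Fin d → V) T {k a} →
             a ∈ T k → (L k , R a) List.∈ edgeList L R T
∈-edgeList {suc n} L R T {zero} a∈ =
  ListP.∈-++⁺ˡ (ListP.∈-map⁺ (λ a → (L zero , R a)) (∈-elements (T zero) a∈))
∈-edgeList {suc n} L R T {suc k} a∈ =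
  ListP.∈-++⁺ʳ (map (λ a → (L zero , R a)) (elements (T zero)))
               (∈-edgeList (λ k → L (suc k)) R (λ k → T (suc k)) a∈)

numEdges-remove : ∀ {n d} (T U : BipGraph n d) i → (∀ k → k ≢ i → T k ≡ U k) →
                  ∣ T i ∣ ≡ suc ∣ U i ∣ → numEdges T ≡ suc (numEdges U)
numEdges-remove {suc n} T U zero same row =
  cong₂ ℕ._+_ row (numEdges-same (λ k → same (suc k) (λ ())))
  where
  numEdges-same : ∀ {n d} {T U : BipGraph n d} → (∀ k → T k ≡ U k) → numEdges T ≡ numEdges U
  numEdges-same {zero}  same = refl
  numEdges-same {suc n} same = cong₂ ℕ._+_ (cong ∣_∣ (same zero)) (numEdges-same (λ k → same (suc k)))
numEdges-remove {suc n} T U (suc i) same row =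
  trans (cong₂ ℕ._+_ (cong ∣_∣ (same zero (λ ())))
                     (numEdges-remove (λ k → T (suc k)) (λ k → U (suc k)) i
                        (λ k k≢i → same (suc k) (λ e → k≢i (FP.suc-injective e))) row))
        (ℕP.+-suc ∣ U zero ∣ _)

module DeleteEdge {n d} (T : BipGraph n d) (i : Fin n) (j : Fin d) where

  T' : BipGraph n d
  T' = delEdge T i j

  delEdge-other : ∀ k → k ≢ i → T' k ≡ T k
  delEdge-other k k≢i with k F.≟ i
  ... | yes k≡i = ⊥-elim (k≢i k≡i)
  ... | no _    = refl

  delEdge-row : T' i ≡ T i [ j ]≔ outside
  delEdge-row with i F.≟ i
  ... | yes _   = refl
  ... | no i≢i = ⊥-elim (i≢i refl)

  edge-survives : ∀ k a → a ∈ T k → (k ≡ i × a ≡ j) ⊎ a ∈ T' k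
  edge-survives k a a∈ with k F.≟ i
  ... | no _     = inj₂ a∈
  ... | yes refl with a F.≟ j
  ...   | yes refl = inj₁ (refl , refl)
  ...   | no a≢j   = inj₂ (∈-remove (T k) j a a∈ a≢j)

  numEdges-delEdge : j ∈ T i → numEdges T ≡ suc (numEdges T')
  numEdges-delEdge j∈ = numEdges-remove T T' i (λ k k≢i → sym (delEdge-other k k≢i))
    (trans (∣∣-remove (T i) j j∈) (cong (λ S → suc ∣ S ∣) (sym delEdge-row)))

  extend : ∀ {u w v} → Adj T' u w →
           Reach T' w v ⊎ (Reach T' w (inj₁ i) ⊎ Reach T' w (inj₂ j)) →
           Reach T' u v ⊎ (Reach T' u (inj₁ i) ⊎ Reach T' u (inj₂ j))
  extend uw (inj₁ p)        = inj₁ (step uw p)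
  extend uw (inj₂ (inj₁ p)) = inj₂ (inj₁ (step uw p))
  extend uw (inj₂ (inj₂ p)) = inj₂ (inj₂ (step uw p))

  -- A path of T either survives in T', or its part before the first use of
  -- e is a path of T' to an endpoint of e.
  Reach-delEdge : ∀ {u v} → Reach T u v →
                  Reach T' u v ⊎ (Reach T' u (inj₁ i) ⊎ Reach T' u (inj₂ j))
  Reach-delEdge here = inj₁ here
  Reach-delEdge (step (lr k a a∈) p) with edge-survives k a a∈
  ... | inj₁ (refl , refl) = inj₂ (inj₁ here)
  ... | inj₂ a∈' = extend (lr k a a∈') (Reach-delEdge p)
  Reach-delEdge (step (rl k a a∈) p) with edge-survives k a a∈
  ... | inj₁ (refl , refl) = inj₂ (inj₂ here)
  ... | inj₂ a∈' = extend (rl k a a∈') (Reach-delEdge p)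

  reaches-endpoint : Connected T → ∀ u → Reach T' u (inj₁ i) ⊎ Reach T' u (inj₂ j)
  reaches-endpoint conn u with Reach-delEdge (conn u (inj₂ j))
  ... | inj₁ p        = inj₂ p
  ... | inj₂ endpoint = endpoint

-- Deleting an edge from a spanning tree disconnects its endpoints: otherwise
-- T' would be connected on n + d vertices with only n + d - 2 edges.
delEdge-separates : ∀ {n d} (T : BipGraph (suc n) d) → SpanningTree T →
                    ∀ i j → j ∈ T i → ¬ Reach (delEdge T i j) (inj₁ i) (inj₂ j)
delEdge-separates {n} {d} T (conn , #edges) i j j∈ i~j = ℕP.<-irrefl refl too-few
  where
  open DeleteEdge T i j
  vertex : Vertex (suc n) d → Fin (suc n ℕ.+ d)
  vertex = join (suc n) d
  left : Fin (suc n) → Fin (suc n ℕ.+ d)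
  left k = vertex (inj₁ k)
  right : Fin d → Fin (suc n ℕ.+ d)
  right a = vertex (inj₂ a)
  es : List (Fin (suc n ℕ.+ d) × Fin (suc n ℕ.+ d))
  es = edgeList left right T'
  invariant-on-paths : ∀ {A : Set} (f : Fin (suc n ℕ.+ d) → A) → EdgeInvariant es f →
                       ∀ {u v} → Reach T' u v → f (vertex u) ≡ f (vertex v)
  invariant-on-paths f inv here = refl
  invariant-on-paths f inv (step (lr k a a∈) p) =
    trans (inv (∈-edgeList left right T' a∈)) (invariant-on-paths f inv p)
  invariant-on-paths f inv (step (rl k a a∈) p) =
    trans (sym (inv (∈-edgeList left right T' a∈))) (invariant-on-paths f inv p)
  to-j : ∀ u → Reach T' u (inj₂ j)
  to-j u with reaches-endpoint conn u
  ... | inj₁ u~i = Reach-trans u~i i~j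
  ... | inj₂ u~j = u~j
  connected : ∀ (f : Fin (suc n ℕ.+ d) → Fin (suc n ℕ.+ d)) → EdgeInvariant es f → ∀ w w' → f w ≡ f w'
  connected f inv w w' = trans (at w) (sym (at w'))
    where
    at : ∀ w → f w ≡ f (vertex (inj₂ j))
    at w = trans (cong f (sym (FP.join-splitAt (suc n) d w)))
                 (invariant-on-paths f inv (to-j (splitAt (suc n) w)))
  too-few : suc n ℕ.+ d ≤ n ℕ.+ d
  too-few = begin
    suc n ℕ.+ d           ≤⟨ connected⇒edges es connected ⟩
    suc (length es)       ≡⟨ cong suc (length-edgeList left right T') ⟩
    suc (numEdges T')     ≡⟨ numEdges-delEdge j∈ ⟨
    numEdges T            ≡⟨ #edges ⟩
    n ℕ.+ d               ∎
    where open ℕP.≤-Reasoning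

unit : ∀ {d} → Fin d → Point d
unit a b = if ⌊ a F.≟ b ⌋ then 1ℚ else 0ℚ

unit-sym : ∀ {d} (a b : Fin d) → unit a b ≡ unit b a
unit-sym a b with a F.≟ b | b F.≟ a
... | yes _   | yes _   = refl
... | no _    | no _    = refl
... | yes a≡b | no b≢a  = ⊥-elim (b≢a (sym a≡b))
... | no a≢b  | yes b≡a = ⊥-elim (a≢b (sym b≡a))

unit-off : ∀ {d} (a b : Fin d) → a ≢ b → unit a b ≡ 0ℚ
unit-off a b a≢b with a F.≟ b
... | yes a≡b = ⊥-elim (a≢b a≡b)
... | no _    = refl

unit-inject₁ : ∀ {d} (a b : Fin d) → unit (inject₁ a) (inject₁ b) ≡ unit a b
unit-inject₁ a b with inject₁ a F.≟ inject₁ b | a F.≟ b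
... | yes _ | yes _    = refl
... | no _  | no _     = refl
... | yes e | no a≢b   = ⊥-elim (a≢b (FP.inject₁-injective e))
... | no e  | yes refl = ⊥-elim (e refl)

sumℚ-unit : ∀ {k} (g : Fin k → ℚ) b → sumℚ (λ a → unit a b * g a) ≡ g b
sumℚ-unit {suc k} g zero = trans (cong₂ _+_ (*-identityˡ (g zero))
    (trans (sumℚ-cong (λ t → *-zeroˡ (g (suc t)))) (sumℚ-zero k))) (+-identityʳ (g zero))
sumℚ-unit {suc k} g (suc b) =
  trans (cong₂ _+_ (*-zeroˡ (g zero))
                   (trans (sumℚ-cong (λ t → cong (_* g (suc t)) (unit-suc t b)))
                          (sumℚ-unit (λ t → g (suc t)) b)))
        (+-identityˡ (g (suc b)))
  where
  unit-suc : ∀ {k} (a b : Fin k) → unit (suc a) (suc b) ≡ unit a b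
  unit-suc a b with a F.≟ b
  ... | yes _ = refl
  ... | no _  = refl

unit∈simplex : ∀ {d} {S : Subset d} {a} → a ∈ S → InSimplex S (unit a)
unit∈simplex {d} {S} {a} a∈S = nonneg , vanish , total
  where
  nonneg : ∀ b → 0ℚ ℚ.≤ unit a b
  nonneg b with a F.≟ b
  ... | yes _ = ℚP.nonNegative⁻¹ 1ℚ
  ... | no _  = ℚP.≤-refl
  vanish : ∀ b → b ∉ S → unit a b ≡ 0ℚ
  vanish b b∉S = unit-off a b (λ a≡b → b∉S (subst (_∈ S) a≡b a∈S))
  total : sumℚ (unit a) ≡ 1ℚ
  total = trans (sumℚ-cong (λ b → trans (unit-sym a b) (sym (*-identityʳ (unit b a)))))
                (sumℚ-unit (λ _ → 1ℚ) a)

-- Masked sums Σ_{a : L a} x_a.  For a subset I of [d] and x ∈ ℚ^{d-1},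
-- 'partialSum I x' is by definition 'maskSum (λ t → lookup I (inject₁ t)) x'.

mask : Bool → ℚ → ℚ
mask b x = if b then x else 0ℚ

maskSum : ∀ {k} → (Fin k → Bool) → (Fin k → ℚ) → ℚ
maskSum L x = sumℚ (λ a → mask (L a) (x a))

mask-zero : ∀ b → mask b 0ℚ ≡ 0ℚ
mask-zero true  = refl
mask-zero false = refl

mask-sumℚ : ∀ {k} b (f : Fin k → ℚ) → mask b (sumℚ f) ≡ sumℚ (λ t → mask b (f t))
mask-sumℚ true  f = refl
mask-sumℚ {k} false f = sym (sumℚ-zero k)

mask-scale : ∀ b c x → mask b (c * x) ≡ c * mask b x
mask-scale true  c x = refl
mask-scale false c x = sym (*-zeroʳ c)

maskSum-sum : ∀ {k r} (L : Fin k → Bool) (q : Fin r → Fin k → ℚ) →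
  maskSum L (λ t → sumℚ (λ s → q s t)) ≡ sumℚ (λ s → maskSum L (q s))
maskSum-sum L q =
  trans (sumℚ-cong (λ t → mask-sumℚ (L t) (λ s → q s t))) (sumℚ-comm (λ t s → mask (L t) (q s t)))

maskSum-combination : ∀ {k r} (L : Fin k → Bool) (c : Fin r → ℚ) (q : Fin r → Fin k → ℚ) →
  maskSum L (λ t → sumℚ (λ s → c s * q s t)) ≡ sumℚ (λ s → c s * maskSum L (q s))
maskSum-combination L c q = trans (maskSum-sum L (λ s t → c s * q s t))
  (sumℚ-cong (λ s → trans (sumℚ-cong (λ t → mask-scale (L t) (c s) (q s t)))
                          (sumℚ-scale (c s) (λ t → mask (L t) (q s t)))))

maskSum-− : ∀ {k} (L : Fin k → Bool) (x y : Fin k → ℚ) →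
  maskSum L (λ t → x t - y t) ≡ maskSum L x - maskSum L y
maskSum-− L x y = trans (sumℚ-cong (λ t → mask-− (L t)))
                        (sumℚ-− (λ t → mask (L t) (x t)) (λ t → mask (L t) (y t)))
  where
  mask-− : ∀ {t} b → mask b (x t - y t) ≡ mask b (x t) - mask b (y t)
  mask-− true  = refl
  mask-− false = refl

maskSum-init : ∀ {m} (L : Fin (suc m) → Bool) (y : Point (suc m)) → L (fromℕ m) ≡ false →
  maskSum (λ t → L (inject₁ t)) (λ t → y (inject₁ t)) ≡ maskSum L y
maskSum-init {m} L y last-unmarked = begin
  maskSum (λ t → L (inject₁ t)) (λ t → y (inject₁ t))        ≡⟨ +-identityʳ _ ⟨
  maskSum (λ t → L (inject₁ t)) (λ t → y (inject₁ t)) + 0ℚ   ≡⟨ cong (maskSum (λ t → L (inject₁ t)) (λ t → y (inject₁ t)) +_) last-term ⟨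
  maskSum (λ t → L (inject₁ t)) (λ t → y (inject₁ t))
    + mask (L (fromℕ m)) (y (fromℕ m))                        ≡⟨ sumℚ-init-last (λ t → mask (L t) (y t)) ⟨
  maskSum L y                                                ∎
  where
  open ≡-Reasoning
  last-term : mask (L (fromℕ m)) (y (fromℕ m)) ≡ 0ℚ
  last-term rewrite last-unmarked = refl

simplex-mass : ∀ {d} {S : Subset d} {p : Point d} (L : Fin d → Bool) (side : Bool) →
  InSimplex S p → (∀ a → a ∈ S → L a ≡ side) → maskSum L p ≡ mask side 1ℚ
simplex-mass {S = S} {p} L side (_ , vanish , total) one-sided = begin
  maskSum L p                     ≡⟨ sumℚ-cong pointwise ⟩
  sumℚ (λ b → mask side (p b))    ≡⟨ mask-sumℚ side p ⟨
  mask side (sumℚ p)              ≡⟨ cong (mask side) total ⟩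
  mask side 1ℚ                    ∎
  where
  open ≡-Reasoning
  pointwise : ∀ b → mask (L b) (p b) ≡ mask side (p b)
  pointwise b with b ∈? S
  ... | yes b∈S = cong (λ s → mask s (p b)) (one-sided b b∈S)
  ... | no b∉S  rewrite vanish b b∉S = trans (mask-zero (L b)) (sym (mask-zero side))

count-ℚ : ∀ {k} (f : Fin k → Bool) → sumℚ (λ t → mask (f t) 1ℚ) ≡ (ℤ.+ count f) / 1
count-ℚ {zero}  f = refl
count-ℚ {suc k} f =
  trans (cong₂ _+_ (bit-ℚ (f zero)) (count-ℚ (λ t → f (suc t))))
        (sym (ℕ/1-+ (bit (f zero)) (count (λ t → f (suc t)))))
  where
  bit-ℚ : ∀ b → mask b 1ℚ ≡ (ℤ.+ bit b) / 1
  bit-ℚ true  = refl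
  bit-ℚ false = refl
  ℕ/1-+ : ∀ a b → (ℤ.+ (a ℕ.+ b)) / 1 ≡ (ℤ.+ a) / 1 + (ℤ.+ b) / 1
  ℕ/1-+ a b = ℚP.toℚᵘ-injective (ℚᵘP.≃-trans (ℚᵘP.≃-trans (ℚP.toℚᵘ-fromℚᵘ (ℚᵘ.mkℚᵘ (ℤ.+ (a ℕ.+ b)) 0)) unnormalised)
    (ℚᵘP.≃-sym (ℚᵘP.≃-trans (ℚP.toℚᵘ-homo-+ ((ℤ.+ a) / 1) ((ℤ.+ b) / 1))
                            (ℚᵘP.+-cong (ℚP.toℚᵘ-fromℚᵘ (ℚᵘ.mkℚᵘ (ℤ.+ a) 0)) (ℚP.toℚᵘ-fromℚᵘ (ℚᵘ.mkℚᵘ (ℤ.+ b) 0))))))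
    where
    unnormalised : ℚᵘ.mkℚᵘ (ℤ.+ (a ℕ.+ b)) 0 ℚᵘ.≃ (ℚᵘ.mkℚᵘ (ℤ.+ a) 0 ℚᵘ.+ ℚᵘ.mkℚᵘ (ℤ.+ b) 0)
    unnormalised = ℚᵘ.*≡* (trans (ℤP.*-identityʳ _) (trans (sym (ℤP.pos-+ a b))
      (sym (trans (ℤP.*-identityʳ _) (cong₂ ℤ._+_ (ℤP.*-identityʳ (ℤ.+ a)) (ℤP.*-identityʳ (ℤ.+ b)))))))

towards : ∀ {m} → (Fin (suc m) → Bool) → Fin (suc m) → Fin (suc m) → Fin (suc m)
towards {m} L r a = if L a then r else fromℕ m

-- Projected to the first m coordinates (so that e_last vanishes),
-- Σ_a u_a (e_a - e_{towards a}) = u - (Σ_{a marked} u_a) e_r.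
telescope : ∀ {m} (L : Fin (suc m) → Bool) (r : Fin (suc m)) (u : Point m) t →
  sumℚ (λ a → u a * (unit (inject₁ a) (inject₁ t) - unit (towards L r (inject₁ a)) (inject₁ t)))
    ≡ u t - unit r (inject₁ t) * maskSum (λ a → L (inject₁ a)) u
telescope {m} L r u t = begin
  sumℚ (λ a → u a * (e (inject₁ a) - e (ρ a)))
    ≡⟨ sumℚ-cong (λ a → distrib (u a) (e (inject₁ a)) (e (ρ a))) ⟩
  sumℚ (λ a → u a * e (inject₁ a) - u a * e (ρ a))
    ≡⟨ sumℚ-− (λ a → u a * e (inject₁ a)) (λ a → u a * e (ρ a)) ⟩
  sumℚ (λ a → u a * e (inject₁ a)) - sumℚ (λ a → u a * e (ρ a))
    ≡⟨ cong₂ _-_ diagonal rooted ⟩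
  u t - unit r (inject₁ t) * maskSum L' u              ∎
  where
  open ≡-Reasoning
  distrib : ∀ x y z → x * (y - z) ≡ x * y - x * z
  distrib = solve 3 (λ x y z → x :* (y :- z) := x :* y :- x :* z) refl
  L' : Fin m → Bool
  L' a = L (inject₁ a)
  e : Fin (suc m) → ℚ
  e a = unit a (inject₁ t)
  ρ : Fin m → Fin (suc m)
  ρ a = towards L r (inject₁ a)
  diagonal : sumℚ (λ a → u a * e (inject₁ a)) ≡ u t
  diagonal = trans (sumℚ-cong (λ a → trans (cong (u a *_) (unit-inject₁ a t)) (*-comm (u a) (unit a t))))
                   (sumℚ-unit u t)
  pointwise : ∀ a → u a * e (ρ a) ≡ unit r (inject₁ t) * mask (L' a) (u a)
  pointwise a with L' a
  ... | true  = *-comm (u a) (unit r (inject₁ t))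
  ... | false = trans (cong (u a *_) (unit-off (fromℕ m) (inject₁ t) FP.fromℕ≢inject₁))
                      (trans (*-zeroʳ (u a)) (sym (*-zeroʳ (unit r (inject₁ t)))))
  rooted : sumℚ (λ a → u a * e (ρ a)) ≡ unit r (inject₁ t) * maskSum L' u
  rooted = trans (sumℚ-cong pointwise) (sumℚ-scale (unit r (inject₁ t)) (λ a → mask (L' a) (u a)))

module AffineHull {m : ℕ} (S : Point m → Set) where

  Hull : Point m → Set
  Hull = InAffineHull S

  hull-≗ : ∀ {x x'} → (∀ t → x t ≡ x' t) → Hull x → Hull x'
  hull-≗ x≗x' (r , c , q , q∈S , Σc≡1 , x≡) = r , c , q , q∈S , Σc≡1 , λ t → trans (sym (x≗x' t)) (x≡ t)

  hull-⊇ : ∀ {y} → S y → Hull y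
  hull-⊇ {y} y∈S = 1 , (λ _ → 1ℚ) , (λ _ → y) , (λ _ → y∈S) , +-identityʳ 1ℚ ,
    λ t → sym (trans (+-identityʳ _) (*-identityˡ (y t)))

  -- The hull is closed under translation by any multiple of y - z, y, z ∈ S:
  -- append y and z to the combination with weights l and - l.
  hull-translate : ∀ {x y z} → Hull x → S y → S z → ∀ l → Hull (λ t → x t + l * (y t - z t))
  hull-translate {x} {y} {z} (r , c , q , q∈S , Σc≡1 , x≡) y∈S z∈S l =
    suc (suc r) , c' , q' , q'∈S , Σc'≡1 , x'≡
    where
    c' : Fin (suc (suc r)) → ℚ
    c' zero          = l
    c' (suc zero)    = - l
    c' (suc (suc s)) = c s
    q' : Fin (suc (suc r)) → Point m
    q' zero          = y
    q' (suc zero)    = z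
    q' (suc (suc s)) = q s
    q'∈S : ∀ s → S (q' s)
    q'∈S zero          = y∈S
    q'∈S (suc zero)    = z∈S
    q'∈S (suc (suc s)) = q∈S s
    Σc'≡1 : sumℚ c' ≡ 1ℚ
    Σc'≡1 = trans (solve 2 (λ l σ → l :+ (:- l :+ σ) := σ) refl l (sumℚ c)) Σc≡1
    x'≡ : ∀ t → x t + l * (y t - z t) ≡ sumℚ (λ s → c' s * q' s t)
    x'≡ t = trans (cong (λ w → w + l * (y t - z t)) (x≡ t))
      (solve 4 (λ X l Y Z → X :+ l :* (Y :- Z) := l :* Y :+ (:- l :* Z :+ X)) refl
         (sumℚ (λ s → c s * q s t)) l (y t) (z t))

  hull-translate-span : ∀ {K} (v : Fin K → Point m) →
    (∀ a x l → Hull x → Hull (λ t → x t + l * v a t)) →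
    ∀ (w : Fin K → ℚ) x → Hull x → Hull (λ t → x t + sumℚ (λ a → w a * v a t))
  hull-translate-span {zero} v closed w x x∈H = hull-≗ (λ t → sym (+-identityʳ (x t))) x∈H
  hull-translate-span {suc K} v closed w x x∈H =
    hull-≗ (λ t → ℚP.+-assoc (x t) (w zero * v zero t) (sumℚ (λ a → w (suc a) * v (suc a) t)))
      (hull-translate-span (λ a → v (suc a)) (λ a → closed (suc a)) (λ a → w (suc a)) _
        (closed zero x (w zero) x∈H))

  hull-level : (L : Fin m → Bool) (v : ℚ) → (∀ {y} → S y → maskSum L y ≡ v) →
               ∀ {x} → Hull x → maskSum L x ≡ v
  hull-level L v level {x} (r , c , q , q∈S , Σc≡1 , x≡) = begin
    maskSum L x                                  ≡⟨ sumℚ-cong (λ t → cong (mask (L t)) (x≡ t)) ⟩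
    maskSum L (λ t → sumℚ (λ s → c s * q s t))   ≡⟨ maskSum-combination L c q ⟩
    sumℚ (λ s → c s * maskSum L (q s))           ≡⟨ sumℚ-cong (λ s → trans (cong (c s *_) (level (q∈S s))) (*-comm (c s) v)) ⟩
    sumℚ (λ s → v * c s)                         ≡⟨ sumℚ-scale v c ⟩
    v * sumℚ c                                   ≡⟨ cong (v *_) Σc≡1 ⟩
    v * 1ℚ                                       ≡⟨ *-identityʳ v ⟩
    v                                            ∎
    where open ≡-Reasoning

module Facet (n' m : ℕ) (T : BipGraph (suc n') (suc m)) (tree : SpanningTree T)
             (i : Fin (suc n')) (j : Fin (suc m)) (j∈Ti : j ∈ T i) (i-inner : 2 ≤ ∣ T i ∣)
             (Ie : Subset (suc m))
             (Ie-def : ∀ k → (k ∈ Ie) ⇔ (¬ Reach (delEdge T i j) (inj₂ k) (inj₂ (fromℕ m)))) where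

  open DeleteEdge T i j

  last : Fin (suc m)
  last = fromℕ m

  side : Fin (suc m) → Bool
  side a = lookup Ie a

  side-true⇒cut : ∀ {a} → side a ≡ true → ¬ Reach T' (inj₂ a) (inj₂ last)
  side-true⇒cut {a} marked = Equivalence.to (Ie-def a) (lookup⇒[]= a Ie marked)

  side-false⇒linked : ∀ {a} → side a ≡ false → ¬ ¬ Reach T' (inj₂ a) (inj₂ last)
  side-false⇒linked {a} unmarked cut with trans (sym ([]=⇒lookup (Equivalence.from (Ie-def a) cut))) unmarked
  ... | ()

  side-last : side last ≡ false
  side-last with side last in marked
  ... | false = refl
  ... | true  = ⊥-elim (side-true⇒cut marked here)

  separated : ¬ Reach T' (inj₁ i) (inj₂ j)
  separated = delEdge-separates T tree i j j∈Ti

  to-endpoint : ∀ u → Reach T' u (inj₁ i) ⊎ Reach T' u (inj₂ j)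
  to-endpoint = reaches-endpoint (proj₁ tree)

  -- Every left vertex keeps a neighbour in T': i because it is not a leaf,
  -- the others because their edges all survive and T is connected.
  neighbour : ∀ k → Σ (Fin (suc m)) (_∈ T' k)
  neighbour k with k F.≟ i
  ... | yes refl = nonempty⇒elem (T k [ j ]≔ outside)
                     (ℕ.s≤s⁻¹ (subst (2 ≤_) (∣∣-remove (T k) j j∈Ti) i-inner))
  ... | no _     = first-edge (proj₁ tree (inj₁ k) (inj₂ j))
    where
    first-edge : Reach T (inj₁ k) (inj₂ j) → Σ (Fin (suc m)) (_∈ T k)
    first-edge (step (lr _ a a∈) _) = a , a∈

  joined⇒same-side : ∀ {a b} → Reach T' (inj₂ a) (inj₂ b) → side a ≡ side b
  joined⇒same-side {a} {b} a~b with side a in ea | side b in eb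
  ... | true  | true  = refl
  ... | false | false = refl
  ... | true  | false = ⊥-elim (side-false⇒linked eb λ b~last → side-true⇒cut ea (Reach-trans a~b b~last))
  ... | false | true  = ⊥-elim (side-false⇒linked ea λ a~last → side-true⇒cut eb (Reach-trans (Reach-sym a~b) a~last))

  across : ∀ {a b} → Reach T' (inj₂ a) (inj₁ i) → Reach T' (inj₂ b) (inj₂ j) → side a ≢ side b
  across {a} {b} a~i b~j same with side a in ea | side b in eb
  across a~i b~j () | true  | false
  across a~i b~j () | false | true
  across a~i b~j _  | true  | true  with to-endpoint (inj₂ last)
  ...   | inj₁ last~i = side-true⇒cut ea (Reach-trans a~i (Reach-sym last~i))
  ...   | inj₂ last~j = side-true⇒cut eb (Reach-trans b~j (Reach-sym last~j))
  across a~i b~j _  | false | false =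
    side-false⇒linked ea λ a~last → side-false⇒linked eb λ b~last →
      separated (Reach-trans (Reach-sym a~i) (Reach-trans a~last (Reach-trans (Reach-sym b~last) b~j)))

  same-side⇒joined : ∀ {a b} → side a ≡ side b → Reach T' (inj₂ a) (inj₂ b)
  same-side⇒joined {a} {b} same with to-endpoint (inj₂ a) | to-endpoint (inj₂ b)
  ... | inj₁ a~i | inj₁ b~i = Reach-trans a~i (Reach-sym b~i)
  ... | inj₂ a~j | inj₂ b~j = Reach-trans a~j (Reach-sym b~j)
  ... | inj₁ a~i | inj₂ b~j = ⊥-elim (across a~i b~j same)
  ... | inj₂ a~j | inj₁ b~i = ⊥-elim (across b~i a~j (sym same))

  choice : Fin (suc n') → Fin (suc m)
  choice k = proj₁ (neighbour k)

  choice∈ : ∀ k → choice k ∈ T' k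
  choice∈ k = proj₂ (neighbour k)

  co-neighbours : ∀ {k a b} → a ∈ T' k → b ∈ T' k → Reach T' (inj₂ a) (inj₂ b)
  co-neighbours {k} {a} {b} a∈ b∈ = step (rl k a a∈) (step (lr k b b∈) here)

  -- j if j ∈ I_e, and otherwise the chosen neighbour of i, which is then
  -- on the other side of the cut from j.
  root : Fin (suc m)
  root = if side j then j else choice i

  side-root : side root ≡ true
  side-root with side j in j-side
  ... | true  = j-side
  ... | false with side (choice i) in i-side
  ...   | true  = refl
  ...   | false = ⊥-elim (across (Reach-sym (step (lr i (choice i) (choice∈ i)) here)) here
                                 (trans i-side (sym j-side)))

  to-root : ∀ a → Reach T' (inj₂ a) (inj₂ (towards side root a))
  to-root a = same-side⇒joined same
    where
    same : side a ≡ side (towards side root a)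
    same with side a
    ... | true  = sym side-root
    ... | false = sym side-last

  Cell : Point m → Set
  Cell = InProjMinkowski T'

  vertexSum : (Fin (suc n') → Fin (suc m)) → Point m
  vertexSum σ t = sumℚ (λ k → unit (σ k) (inject₁ t))

  vertexSum∈Cell : ∀ σ → (∀ k → σ k ∈ T' k) → Cell (vertexSum σ)
  vertexSum∈Cell σ σ∈ =
    (λ b → sumℚ (λ k → unit (σ k) b)) ,
    ((λ k → unit (σ k)) , (λ k → unit∈simplex (σ∈ k)) , (λ _ → refl)) , (λ _ → refl)

  reroute : Fin (suc n') → Fin (suc m) → Fin (suc n') → Fin (suc m)
  reroute k₀ a k = if ⌊ k F.≟ k₀ ⌋ then a else choice k

  reroute∈ : ∀ {k₀ a} → a ∈ T' k₀ → ∀ k → reroute k₀ a k ∈ T' k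
  reroute∈ {k₀} a∈ k with k F.≟ k₀
  ... | yes refl = a∈
  ... | no _     = choice∈ k

  direction : Fin (suc m) → Fin (suc m) → Point m
  direction a b t = unit a (inject₁ t) - unit b (inject₁ t)

  reroute-difference : ∀ k₀ a b t →
    vertexSum (reroute k₀ a) t - vertexSum (reroute k₀ b) t ≡ direction a b t
  reroute-difference k₀ a b t =
    trans (sym (sumℚ-− (λ k → unit (reroute k₀ a k) (inject₁ t)) (λ k → unit (reroute k₀ b k) (inject₁ t))))
          (trans (sumℚ-cong pointwise) (sumℚ-unit (λ _ → direction a b t) k₀))
    where
    pointwise : ∀ k → unit (reroute k₀ a k) (inject₁ t) - unit (reroute k₀ b k) (inject₁ t)
                        ≡ unit k k₀ * direction a b t
    pointwise k with k F.≟ k₀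
    ... | yes _ = sym (*-identityˡ (direction a b t))
    ... | no _  = trans (+-inverseʳ (unit (choice k) (inject₁ t))) (sym (*-zeroˡ (direction a b t)))

  open AffineHull Cell

  hull-adjacent : ∀ {k a b} → a ∈ T' k → b ∈ T' k →
                  ∀ x l → Hull x → Hull (λ t → x t + l * direction a b t)
  hull-adjacent {k} {a} {b} a∈ b∈ x l x∈H =
    hull-≗ (λ t → cong (λ v → x t + l * v) (reroute-difference k a b t))
      (hull-translate x∈H (vertexSum∈Cell _ (reroute∈ a∈)) (vertexSum∈Cell _ (reroute∈ b∈)) l)

  hull-joined : ∀ {a b} → Reach T' (inj₂ a) (inj₂ b) →
                ∀ x l → Hull x → Hull (λ t → x t + l * direction a b t)
  hull-joined {a} here x l x∈H =
    hull-≗ (λ t → solve 3 (λ X l e → X := X :+ l :* (e :- e)) refl (x t) l (unit a (inject₁ t))) x∈H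
  hull-joined {a} {b} (step (rl k .a a∈) (step (lr .k c c∈) c~b)) x l x∈H =
    hull-≗ (λ t → solve 5 (λ X l p q r → (X :+ l :* (p :- q)) :+ l :* (q :- r) := X :+ l :* (p :- r)) refl
                    (x t) l (unit a (inject₁ t)) (unit c (inject₁ t)) (unit b (inject₁ t)))
      (hull-joined c~b _ l (hull-adjacent a∈ c∈ x l x∈H))

  level : ℚ
  level = sumℚ (λ k → mask (side (choice k)) 1ℚ)

  level-integral : level ≡ (ℤ.+ count (λ k → side (choice k))) / 1
  level-integral = count-ℚ (λ k → side (choice k))

  cell⇒level : ∀ {x} → Cell x → partialSum Ie x ≡ level
  cell⇒level {x} (y , (p , p∈ , y≡) , x≡) = begin
    partialSum Ie x                                ≡⟨ sumℚ-cong (λ t → cong (mask (side (inject₁ t))) (x≡ t)) ⟩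
    maskSum (λ t → side (inject₁ t)) (λ t → y (inject₁ t)) ≡⟨ maskSum-init side y side-last ⟩
    maskSum side y                                 ≡⟨ sumℚ-cong (λ b → cong (mask (side b)) (y≡ b)) ⟩
    maskSum side (λ b → sumℚ (λ k → p k b))        ≡⟨ maskSum-sum side p ⟩
    sumℚ (λ k → maskSum side (p k))                ≡⟨ sumℚ-cong one-sided ⟩
    level                                          ∎
    where
    open ≡-Reasoning
    one-sided : ∀ k → maskSum side (p k) ≡ mask (side (choice k)) 1ℚ
    one-sided k = simplex-mass side _ (p∈ k) (λ a a∈ → joined⇒same-side (co-neighbours a∈ (choice∈ k)))

  hull⇒level : ∀ {x} → Hull x → partialSum Ie x ≡ level
  hull⇒level = hull-level (λ t → side (inject₁ t)) level cell⇒level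

  -- (⇐) Starting from base = Σ_k e_{choice k}, x = base + Σ_a u_a (e_a - e_{ρ a})
  -- with u = x - base and ρ = towards side root, because Σ_{a ∈ I_e} u_a = 0.

  base : Point m
  base = vertexSum choice

  base∈Cell : Cell base
  base∈Cell = vertexSum∈Cell choice choice∈

  level⇒hull : ∀ x → partialSum Ie x ≡ level → Hull x
  level⇒hull x x-level = hull-≗ reconstruct spanned
    where
    u : Point m
    u t = x t - base t
    ρ : Fin m → Fin (suc m)
    ρ a = towards side root (inject₁ a)
    spanned : Hull (λ t → base t + sumℚ (λ a → u a * direction (inject₁ a) (ρ a) t))
    spanned = hull-translate-span (λ a → direction (inject₁ a) (ρ a))
                (λ a → hull-joined (to-root (inject₁ a))) u base (hull-⊇ base∈Cell)
    u-level : maskSum (λ t → side (inject₁ t)) u ≡ 0ℚ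
    u-level = trans (maskSum-− (λ t → side (inject₁ t)) x base)
              (trans (cong₂ _-_ x-level (cell⇒level base∈Cell)) (+-inverseʳ level))
    reconstruct : ∀ t → base t + sumℚ (λ a → u a * direction (inject₁ a) (ρ a) t) ≡ x t
    reconstruct t = begin
      base t + sumℚ (λ a → u a * direction (inject₁ a) (ρ a) t)
        ≡⟨ cong (base t +_) (telescope side root u t) ⟩
      base t + (u t - unit root (inject₁ t) * maskSum (λ t → side (inject₁ t)) u)
        ≡⟨ cong (λ v → base t + (u t - unit root (inject₁ t) * v)) u-level ⟩
      base t + ((x t - base t) - unit root (inject₁ t) * 0ℚ)
        ≡⟨ solve 3 (λ B X e → B :+ ((X :- B) :- e :* con 0ℚ) := X) refl (base t) (x t) (unit root (inject₁ t)) ⟩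
      x t ∎
      where open ≡-Reasoning

lemma4p8 : (n' m : ℕ) → (T : BipGraph (suc n') (suc m)) → SpanningTree T →
    (i : Fin (suc n')) (j : Fin (suc m)) → j ∈ T i → 2 ≤ ∣ T i ∣ →
    (Ie : Subset (suc m)) →
    (∀ k → (k ∈ Ie) ⇔ (¬ Reach (delEdge T i j) (inj₂ k) (inj₂ (fromℕ m)))) →
    Σ ℤ λ c → ∀ (x : Point m) →
    InAffineHull (InProjMinkowski (delEdge T i j)) x ⇔ (partialSum Ie x ≡ c / 1)
lemma4p8 n' m T tree i j j∈Ti i-inner Ie Ie-def =
  ℤ.+ count (λ k → side (choice k)) , λ x →
    mk⇔ (λ x∈hull → trans (hull⇒level x∈hull) level-integral)
        (λ x-level → level⇒hull x (trans x-level (sym level-integral)))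
  where open Facet n' m T tree i j j∈Ti i-inner Ie Ie-def
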